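{- Let $G_1$ and $G_2$ be finite simple connected bipartite graphs, and suppose $\mathcal{P}_{G_1}$ and $\mathcal{P}_{G_2}$ have $f_1$ and $f_2$ facets respectively. Let $G$ be the graph obtained from the disjoint union of $G_1$ and $G_2$ by identifying an edge $\{v_1,w_1\}$ of $G_1$ with an edge $\{v_2,w_2\}$ of $G_2$ (identifying $v_1$ with $v_2$, $w_1$ with $w_2$, and the two edges with each other). Then $\mathcal{P}_G$ has $\frac{1}{2}f_1f_2$ facets.
   Context: For a graph $H=(V,E)$, the symmetric edge polytope is $\mathcal{P}_H:=\mathrm{conv}\{\mathbf{e}_v-\mathbf{e}_w,\ \mathbf{e}_w-\mathbf{e}_v : \{v,w\}\in E\}\subset\mathbb{R}^V$. -}

module Defs where

open import Data.Bool using (Bool; true; false; not)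
open import Data.Nat using (ℕ)
open import Data.Fin using (Fin)
open import Data.Product using (Σ; ∃; _×_; _,_)
open import Data.Sum using (_⊎_)
open import Data.Rational using (ℚ; _-_; _≤_)
open import Relation.Binary.PropositionalEquality using (_≡_; _≢_)
open import Relation.Nullary using (¬_)

record Graph (n : ℕ) : Set where
  field
    adj   : Fin n → Fin n → Bool
    sym   : ∀ i j → adj i j ≡ adj j i
    irrefl : ∀ i → adj i i ≡ false
open Graph public

data Reach {n : ℕ} (H : Graph n) : Fin n → Fin n → Set where
  here : ∀ {i} → Reach H i i
  step : ∀ {i j k} → adj H i j ≡ true → Reach H j k → Reach H i k

Connected : ∀ {n} → Graph n → Set
Connected H = ∀ i j → Reach H i j

Bipartite : ∀ {n} → Graph n → Set
Bipartite {n} H = Σ (Fin n → Bool) λ c → ∀ i j → adj H i j ≡ true → c i ≢ c j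

-- The symmetric edge polytope P_H = conv{ e_i - e_j : adj H i j } ⊂ ℚ^n
-- (the set of generators e_v - e_w, e_w - e_v over edges {v,w} is exactly the
-- set of e_i - e_j over ordered adjacent pairs (i,j)).
-- A face of P_H is recorded by the set of generators it contains, encoded as a
-- predicate on ordered pairs (i,j) (meaningful on adjacent pairs only).
PointSet : ℕ → Set
PointSet n = Fin n → Fin n → Bool

_≈[_]_ : ∀ {n} → PointSet n → Graph n → PointSet n → Set
F ≈[ H ] F' = ∀ i j → adj H i j ≡ true → F i j ≡ F' i j

_⊆[_]_ : ∀ {n} → PointSet n → Graph n → PointSet n → Set
F ⊆[ H ] F' = ∀ i j → adj H i j ≡ true → F i j ≡ true → F' i j ≡ true

-- Note a·(e_i - e_j) = a i - a j.
-- (The empty face is included, arising from c larger than the maximum.)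
IsFace : ∀ {n} → Graph n → PointSet n → Set
IsFace {n} H F =
  Σ (Fin n → ℚ) λ a → Σ ℚ λ c →
    (∀ i j → adj H i j ≡ true → (a i - a j) ≤ c) ×
    (∀ i j → adj H i j ≡ true → (F i j ≡ true → (a i - a j) ≡ c) × ((a i - a j) ≡ c → F i j ≡ true))

Full : ∀ {n} → Graph n → PointSet n
Full H = adj H

IsProperFace : ∀ {n} → Graph n → PointSet n → Set
IsProperFace H F = IsFace H F × ¬ (F ≈[ H ] Full H)

IsFacet : ∀ {n} → Graph n → PointSet n → Set
IsFacet H F = IsProperFace H F × (∀ F' → IsProperFace H F' → F ⊆[ H ] F' → F' ≈[ H ] F)

HasFacets : ∀ {n} → Graph n → ℕ → Set
HasFacets {n} H f =
  Σ (Fin f → PointSet n) λ F →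
    (∀ k → IsFacet H (F k)) ×
    (∀ k l → F k ≈[ H ] F l → k ≡ l) ×
    (∀ S → IsFacet H S → ∃ λ k → F k ≈[ H ] S)

record EdgeGluing {n₁ n₂ n : ℕ} (G₁ : Graph n₁) (G₂ : Graph n₂) (G : Graph n)
                  (v₁ w₁ : Fin n₁) (v₂ w₂ : Fin n₂) : Set where
  field
    ι₁ : Fin n₁ → Fin n
    ι₂ : Fin n₂ → Fin n
    ι₁-inj : ∀ x y → ι₁ x ≡ ι₁ y → x ≡ y
    ι₂-inj : ∀ x y → ι₂ x ≡ ι₂ y → x ≡ y
    glue-v : ι₁ v₁ ≡ ι₂ v₂
    glue-w : ι₁ w₁ ≡ ι₂ w₂
    meet : ∀ x y → ι₁ x ≡ ι₂ y → (x ≡ v₁ × y ≡ v₂) ⊎ (x ≡ w₁ × y ≡ w₂)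
    cover : ∀ u → (∃ λ x → ι₁ x ≡ u) ⊎ (∃ λ y → ι₂ y ≡ u)
    adj₁ : ∀ x y → adj G (ι₁ x) (ι₁ y) ≡ adj G₁ x y
    adj₂ : ∀ x y → adj G (ι₂ x) (ι₂ y) ≡ adj G₂ x y
    adj-from : ∀ u u' → adj G u u' ≡ true →
      (∃ λ x → ∃ λ y → ι₁ x ≡ u × ι₁ y ≡ u' × adj G₁ x y ≡ true) ⊎
      (∃ λ x → ∃ λ y → ι₂ x ≡ u × ι₂ y ≡ u' × adj G₂ x y ≡ true)

-- For bipartite H every facet of P_H is cut out by a unit potential: a g : V → ℚ with
-- g i - g j = ±1 on every edge, the facet being {e_i - e_j : g i - g j = 1}. To find it, scale a
-- facet normal so that its maximum on P_H is 1 and round each coordinate b into (b - 1, b + 1]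
-- with the parity of its colour class. Unit potentials on G₁ and G₂ glue, after a shift, exactly
-- when they orient the common edge the same way, so the facets of G correspond to the pairs of
-- facets of G₁ and G₂ that agree on that edge. Transposing the facets of G₂ reverses the edge,
-- so exactly half of the f₁ f₂ pairs agree.
module Submission where

open import Defs hiding (sym)
open import Data.Bool using (Bool; true; false; not; _xor_)
open import Data.Bool.Properties using (not-¬; not-distribʳ-xor)
open import Data.Nat using (ℕ; zero; suc; _*_)
import Data.Nat as ℕ
import Data.Nat.Properties as ℕ
open import Data.Fin using (Fin; zero; suc; combine; remQuot)
import Data.Fin.Properties as Fin
open import Data.Integer as ℤ using (ℤ; +_)
import Data.Integer.Properties as ℤ
open import Data.Integer.DivMod using (_/ℕ_; _%ℕ_; a≡a%ℕn+[a/ℕn]*n; n%ℕd<d)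
open import Data.Nat.Divisibility using (∣1⇒≡1)
open import Data.Rational
  using (ℚ; mkℚ; _+_; _-_; -_; _≤_; _<_; 0ℚ; 1ℚ; ½; *≤*; *<*; _≟_; 1/_)
open import Data.Rational using (Positive; NonNegative; NonZero; positive)
  renaming (_*_ to _·_)
open import Data.Rational.Properties
import Data.Rational.Unnormalised as ℚᵘ
import Data.Rational.Unnormalised.Properties as ℚᵘ
open import Data.Rational.Solver using (module +-*-Solver)
open +-*-Solver
open import Data.Product using (Σ; ∃; _×_; _,_; proj₁; proj₂)
open import Data.Sum using (_⊎_; inj₁; inj₂; [_,_])
open import Data.Empty using (⊥-elim)
open import Function.Definitions using (Injective)
open import Relation.Nullary using (¬_; yes)
open import Relation.Nullary.Decidable using (does; dec-true; dec-false)
open import Relation.Binary.Definitions using (tri<; tri≈; tri>)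
open import Relation.Binary.PropositionalEquality
  using (_≡_; _≢_; refl; sym; trans; cong; cong₂; subst; subst₂; module ≡-Reasoning)

opaque
  fromℤ : ℤ → ℚ
  fromℤ z = mkℚ z 0 (λ {d} x → ∣1⇒≡1 (proj₂ x))

opaque
  unfolding fromℤ

  fromℤ-+ : ∀ x y → fromℤ (x ℤ.+ y) ≡ fromℤ x + fromℤ y
  fromℤ-+ x y = toℚᵘ-injective (ℚᵘ.≃-trans (ℚᵘ.*≡* eq) (ℚᵘ.≃-sym (toℚᵘ-homo-+ (fromℤ x) (fromℤ y))))
    where
    open ≡-Reasoning
    eq : (x ℤ.+ y) ℤ.* + 1 ≡ (x ℤ.* + 1 ℤ.+ y ℤ.* + 1) ℤ.* + 1
    eq = begin
      (x ℤ.+ y) ℤ.* + 1                 ≡⟨ ℤ.*-identityʳ _ ⟩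
      x ℤ.+ y                           ≡⟨ sym (cong₂ ℤ._+_ (ℤ.*-identityʳ x) (ℤ.*-identityʳ y)) ⟩
      x ℤ.* + 1 ℤ.+ y ℤ.* + 1           ≡⟨ sym (ℤ.*-identityʳ _) ⟩
      (x ℤ.* + 1 ℤ.+ y ℤ.* + 1) ℤ.* + 1 ∎

  fromℤ-1 : fromℤ (+ 1) ≡ 1ℚ
  fromℤ-1 = refl

  fromℤ-cancel-< : ∀ {x y} → fromℤ x < fromℤ y → x ℤ.< y
  fromℤ-cancel-< {x} {y} (*<* p) = subst₂ ℤ._<_ (ℤ.*-identityʳ x) (ℤ.*-identityʳ y) p

  fromℤ-mono-≤ : ∀ {x y} → x ℤ.≤ y → fromℤ x ≤ fromℤ y
  fromℤ-mono-≤ {x} {y} p = *≤* (subst₂ ℤ._≤_ (sym (ℤ.*-identityʳ x)) (sym (ℤ.*-identityʳ y)) p)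

  floor-bounds : ∀ q → ∃ λ m → fromℤ m ≤ q × q < fromℤ m + 1ℚ
  floor-bounds (mkℚ n d c) = m , lower , subst (mkℚ n d c <_) (fromℤ-+ m (+ 1)) upper
    where
    m : ℤ
    m = n /ℕ suc d
    division : n ≡ + (n %ℕ suc d) ℤ.+ m ℤ.* + suc d
    division = a≡a%ℕn+[a/ℕn]*n n (suc d)
    n≡n·1 : n ≡ n ℤ.* + 1
    n≡n·1 = sym (ℤ.*-identityʳ n)
    lower : fromℤ m ≤ mkℚ n d c
    lower = *≤* (subst (m ℤ.* + suc d ℤ.≤_) (trans (sym division) n≡n·1) (ℤ.i≤j+i _ (+ (n %ℕ suc d))))
    upper : mkℚ n d c < fromℤ (m ℤ.+ + 1)
    upper = *<* (subst₂ ℤ._<_ (trans (sym division) n≡n·1) shift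
                  (ℤ.+-monoˡ-< (m ℤ.* + suc d) (ℤ.+<+ (n%ℕd<d n (suc d)))))
      where
      shift : + suc d ℤ.+ m ℤ.* + suc d ≡ (m ℤ.+ + 1) ℤ.* + suc d
      shift = trans (cong (ℤ._+ m ℤ.* + suc d) (sym (ℤ.*-identityˡ (+ suc d))))
                (trans (ℤ.+-comm (+ 1 ℤ.* + suc d) (m ℤ.* + suc d)) (sym (ℤ.*-distribʳ-+ (+ suc d) m (+ 1))))

fromℤ-suc : ∀ x → fromℤ (x ℤ.+ + 1) ≡ fromℤ x + 1ℚ
fromℤ-suc x = trans (fromℤ-+ x (+ 1)) (cong (_+_ (fromℤ x)) fromℤ-1)

fromℤ-<⇒+1≤ : ∀ {x y} → fromℤ x < fromℤ y → fromℤ x + 1ℚ ≤ fromℤ y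
fromℤ-<⇒+1≤ {x} {y} x<y =
  subst (_≤ fromℤ y) (trans (cong fromℤ (ℤ.+-comm (+ 1) x)) (fromℤ-suc x))
    (fromℤ-mono-≤ (ℤ.i<j⇒suc[i]≤j (fromℤ-cancel-< x<y)))

≤-translate : ∀ {a b} → a ≤ b → ∀ k {c d} → a + k ≡ c → b + k ≡ d → c ≤ d
≤-translate a≤b k refl refl = +-monoˡ-≤ k a≤b

<-translate : ∀ {a b} → a < b → ∀ k {c d} → a + k ≡ c → b + k ≡ d → c < d
<-translate a<b k refl refl = +-monoˡ-< k a<b

_≡±1 : ℚ → Set
d ≡±1 = d ≡ 1ℚ ⊎ d ≡ - 1ℚ

1≢-1 : 1ℚ ≢ - 1ℚ
1≢-1 ()

-1≤1 : - 1ℚ ≤ 1ℚ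
-1≤1 = *≤* ℤ.-≤+

-‿diff : ∀ a b → a - b ≡ - (b - a)
-‿diff = solve 2 (λ a b → a :- b := :- (b :- a)) refl

≡±1-swap : ∀ {a b} → (b - a) ≡±1 → (a - b) ≡±1
≡±1-swap {a} {b} (inj₁ e) = inj₂ (trans (-‿diff a b) (cong -_ e))
≡±1-swap {a} {b} (inj₂ e) = inj₁ (trans (-‿diff a b) (cong -_ e))

≡±1-by-ascent : ∀ {d d'} → d ≡±1 → d' ≡±1 → does (d ≟ 1ℚ) ≡ does (d' ≟ 1ℚ) → d ≡ d'
≡±1-by-ascent (inj₁ refl) (inj₁ refl) _ = refl
≡±1-by-ascent (inj₂ refl) (inj₂ refl) _ = refl
≡±1-by-ascent (inj₁ refl) (inj₂ refl) ()
≡±1-by-ascent (inj₂ refl) (inj₁ refl) ()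

bit : Bool → ℚ
bit true = 1ℚ
bit false = 0ℚ

parityValue : ℤ → Bool → ℚ
parityValue m π = fromℤ m + fromℤ m + bit π

record Rounds (b g : ℚ) : Set where
  constructor rounding
  field
    below : g ≤ b + 1ℚ
    above : b - 1ℚ < g

-- m = ⌊(b + 1 - π) / 2⌋, so that 2m + π ≤ b + 1 < 2m + π + 2.
parity-rounding : ∀ b π → ∃ λ m → Rounds b (parityValue m π)
parity-rounding b π = m , rounding below above
  where
  p : ℚ
  p = bit π
  half : ℚ
  half = (b + 1ℚ - p) · ½
  m : ℤ
  m = proj₁ (floor-bounds half)
  N : ℚ
  N = fromℤ m
  below : N + N + p ≤ b + 1ℚ
  below = ≤-translate (+-mono-≤ (proj₁ (proj₂ (floor-bounds half))) (proj₁ (proj₂ (floor-bounds half)))) p refl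
    (solve 2 (λ b p → (b :+ con 1ℚ :- p) :* con ½ :+ (b :+ con 1ℚ :- p) :* con ½ :+ p := b :+ con 1ℚ) refl b p)
  above : b - 1ℚ < N + N + p
  above = <-translate (+-mono-< (proj₂ (proj₂ (floor-bounds half))) (proj₂ (proj₂ (floor-bounds half))))
    (p - 1ℚ - 1ℚ)
    (solve 2 (λ b p → (b :+ con 1ℚ :- p) :* con ½ :+ (b :+ con 1ℚ :- p) :* con ½ :+ (p :- con 1ℚ :- con 1ℚ)
                       := b :- con 1ℚ) refl b p)
    (solve 2 (λ N p → (N :+ con 1ℚ) :+ (N :+ con 1ℚ) :+ (p :- con 1ℚ :- con 1ℚ) := N :+ N :+ p) refl N p)

three : ℚ
three = 1ℚ + 1ℚ + 1ℚ

rounded-diff-<3 : ∀ {bi bj gi gj} → Rounds bi gi → Rounds bj gj → bi - bj ≤ 1ℚ → gi - gj < three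
rounded-diff-<3 {bi} {bj} (rounding gi≤ _) (rounding _ <gj) bi-bj≤1 =
  <-≤-trans (+-mono-≤-< gi≤ (neg-antimono-< <gj))
  (≤-translate bi-bj≤1 (1ℚ + 1ℚ)
    (solve 3 (λ a b o → a :- b :+ (o :+ o) := a :+ o :+ :- (b :- o)) refl bi bj 1ℚ)
    (solve 1 (λ o → o :+ (o :+ o) := o :+ o :+ o) refl 1ℚ))

<⇒≱ : ∀ {p q} → p < q → ¬ (q ≤ p)
<⇒≱ p<q q≤p = <-irrefl refl (<-≤-trans p<q q≤p)

oddEvenGap : ℚ → ℚ → ℚ
oddEvenGap X Y = X + X + 1ℚ - (Y + Y + 0ℚ)

oddEvenGap-refl : ∀ X → oddEvenGap X X ≡ 1ℚ
oddEvenGap-refl = solve 1 (λ X → X :+ X :+ con 1ℚ :- (X :+ X :+ con 0ℚ) := con 1ℚ) refl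

oddEvenGap-suc : ∀ X → oddEvenGap X (X + 1ℚ) ≡ - 1ℚ
oddEvenGap-suc =
  solve 1 (λ X → X :+ X :+ con 1ℚ :- ((X :+ con 1ℚ) :+ (X :+ con 1ℚ) :+ con 0ℚ) := :- con 1ℚ) refl

oddEvenGap-≥3 : ∀ {X Y} → Y + 1ℚ ≤ X → three ≤ oddEvenGap X Y
oddEvenGap-≥3 {X} {Y} Y+1≤X = ≤-translate (+-mono-≤ Y+1≤X Y+1≤X) (1ℚ - Y - Y)
  (solve 1 (λ Y → (Y :+ con 1ℚ) :+ (Y :+ con 1ℚ) :+ (con 1ℚ :- Y :- Y) := con 1ℚ :+ con 1ℚ :+ con 1ℚ) refl Y)
  (solve 2 (λ X Y → X :+ X :+ (con 1ℚ :- Y :- Y) := X :+ X :+ con 1ℚ :- (Y :+ Y :+ con 0ℚ)) refl X Y)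

evenOddGap-≥3 : ∀ {X Y} → X + 1ℚ + 1ℚ ≤ Y → three ≤ Y + Y + 0ℚ - (X + X + 1ℚ)
evenOddGap-≥3 {X} {Y} X+2≤Y = ≤-translate (+-mono-≤ X+2≤Y X+2≤Y) (- X - X - 1ℚ)
  (solve 1 (λ X → (X :+ con 1ℚ :+ con 1ℚ) :+ (X :+ con 1ℚ :+ con 1ℚ) :+ (:- X :- X :- con 1ℚ)
                    := con 1ℚ :+ con 1ℚ :+ con 1ℚ) refl X)
  (solve 2 (λ X Y → Y :+ Y :+ (:- X :- X :- con 1ℚ) := Y :+ Y :+ con 0ℚ :- (X :+ X :+ con 1ℚ)) refl X Y)

-- The gap is 2(x - y) + 1; comparing x with y and x + 1 with y leaves only y = x or y = x + 1.
odd-minus-even-≡±1 : ∀ x y → parityValue x true - parityValue y false < three →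
  parityValue y false - parityValue x true < three → (parityValue x true - parityValue y false) ≡±1
odd-minus-even-≡±1 x y gap<3 -gap<3 with <-cmp (fromℤ x) (fromℤ y)
... | tri≈ _ x≡y _ = inj₁ (trans (cong (oddEvenGap (fromℤ x)) (sym x≡y)) (oddEvenGap-refl (fromℤ x)))
... | tri> _ _ y<x = ⊥-elim (<⇒≱ gap<3 (oddEvenGap-≥3 {fromℤ x} {fromℤ y} (fromℤ-<⇒+1≤ y<x)))
... | tri< x<y _ _ with <-cmp (fromℤ (x ℤ.+ + 1)) (fromℤ y)
...   | tri≈ _ x+1≡y _ =
  inj₂ (trans (cong (oddEvenGap (fromℤ x)) (trans (sym x+1≡y) (fromℤ-suc x))) (oddEvenGap-suc (fromℤ x)))
...   | tri> _ _ y<x+1 = ⊥-elim (<⇒≱ y<x+1 (subst (_≤ fromℤ y) (sym (fromℤ-suc x)) (fromℤ-<⇒+1≤ x<y)))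
...   | tri< x+1<y _ _ =
  ⊥-elim (<⇒≱ -gap<3 (evenOddGap-≥3 {fromℤ x} {fromℤ y}
    (subst (λ t → t + 1ℚ ≤ fromℤ y) (fromℤ-suc x) (fromℤ-<⇒+1≤ x+1<y))))

opposite-parity-≡±1 : ∀ {bi bj mi mj} πi πj → πi ≢ πj →
  Rounds bi (parityValue mi πi) → Rounds bj (parityValue mj πj) → bi - bj ≤ 1ℚ → bj - bi ≤ 1ℚ →
  (parityValue mi πi - parityValue mj πj) ≡±1
opposite-parity-≡±1 {mi = mi} {mj} true false _ ri rj ij ji =
  odd-minus-even-≡±1 mi mj (rounded-diff-<3 ri rj ij) (rounded-diff-<3 rj ri ji)
opposite-parity-≡±1 {mi = mi} {mj} false true _ ri rj ij ji =
  ≡±1-swap {parityValue mi false} {parityValue mj true}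
    (odd-minus-even-≡±1 mj mi (rounded-diff-<3 rj ri ji) (rounded-diff-<3 ri rj ij))
opposite-parity-≡±1 true true πi≢πj = ⊥-elim (πi≢πj refl)
opposite-parity-≡±1 false false πi≢πj = ⊥-elim (πi≢πj refl)

rounding-keeps-ascent : ∀ {bi bj gi gj} → Rounds bi gi → Rounds bj gj → bi - bj ≡ 1ℚ → gi - gj ≢ - 1ℚ
rounding-keeps-ascent {bi} {bj} {gi} {gj} (rounding _ <gi) (rounding gj≤ _) tight descent =
  <-irrefl refl (subst₂ _<_ sum descent (+-mono-<-≤ <gi (neg-antimono-≤ gj≤)))
  where
  sum : bi - 1ℚ + - (bj + 1ℚ) ≡ - 1ℚ
  sum = trans (solve 3 (λ a b o → a :- o :+ :- (b :+ o) := (a :- b) :- o :- o) refl bi bj 1ℚ)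
              (trans (cong (λ t → t - 1ℚ - 1ℚ) tight) (solve 1 (λ o → o :- o :- o := :- o) refl 1ℚ))

scaled-to-one : ∀ c → 0ℚ < c → Σ ℚ λ w → (∀ x → x ≤ c → x · w ≤ 1ℚ) × c · w ≡ 1ℚ
scaled-to-one c 0<c =
  1/ c , (λ x x≤c → subst (x · 1/ c ≤_) (*-inverseʳ c) (*-monoʳ-≤-nonNeg (1/ c) x≤c)) , *-inverseʳ c
  where
  instance
    c-positive : Positive c
    c-positive = positive 0<c
    c-nonZero : NonZero c
    c-nonZero = pos⇒nonZero c
    1/c-nonNegative : NonNegative (1/ c)
    1/c-nonNegative = pos⇒nonNeg (1/ c) {{1/pos⇒pos c}}

·-distribʳ-‿ : ∀ x y w → x · w - y · w ≡ (x - y) · w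
·-distribʳ-‿ = solve 3 (λ x y w → x :* w :- y :* w := (x :- y) :* w) refl

adj-sym : ∀ {n} (H : Graph n) {i j} → adj H i j ≡ true → adj H j i ≡ true
adj-sym H {i} {j} e = trans (Graph.sym H j i) e

Edgeless : ∀ {n} → Graph n → Set
Edgeless {n} H = ∀ (i j : Fin n) → adj H i j ≢ true

edgeless⇒full : ∀ {n} {H : Graph n} {S : PointSet n} → Edgeless H → S ≈[ H ] Full H
edgeless⇒full edgeless i j e = ⊥-elim (edgeless i j e)

_ᵀ : ∀ {n} → PointSet n → PointSet n
(S ᵀ) i j = S j i

infix 30 _ᵀ

IsFace-resp-≈ : ∀ {n} {H : Graph n} {S S'} → S ≈[ H ] S' → IsFace H S → IsFace H S'
IsFace-resp-≈ S≈S' (a , c , bound , tight) =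
  a , c , bound , λ i j e → (λ s → proj₁ (tight i j e) (trans (S≈S' i j e) s)) ,
                            (λ t → trans (sym (S≈S' i j e)) (proj₂ (tight i j e) t))

IsFacet-resp-≈ : ∀ {n} {H : Graph n} {S S'} → S ≈[ H ] S' → IsFacet H S → IsFacet H S'
IsFacet-resp-≈ {H = H} S≈S' ((face , notFull) , maximal) =
  (IsFace-resp-≈ {H = H} S≈S' face , λ full → notFull (λ i j e → trans (S≈S' i j e) (full i j e))) ,
  λ F proper S'⊆F i j e →
    trans (maximal F proper (λ i j e s → S'⊆F i j e (trans (sym (S≈S' i j e)) s)) i j e) (S≈S' i j e)

ᵀ-full : ∀ {n} {H : Graph n} {S} → S ᵀ ≈[ H ] Full H → S ≈[ H ] Full H
ᵀ-full {H = H} full i j e = trans (full j i (adj-sym H e)) (Graph.sym H j i)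

IsFace-ᵀ : ∀ {n} {H : Graph n} {S} → IsFace H S → IsFace H (S ᵀ)
IsFace-ᵀ {H = H} (a , c , bound , tight) = (λ i → - a i) , c ,
  (λ i j e → subst (_≤ c) (sym (-a-diff i j)) (bound j i (adj-sym H e))) ,
  λ i j e → (λ s → trans (-a-diff i j) (proj₁ (tight j i (adj-sym H e)) s)) ,
            (λ t → proj₂ (tight j i (adj-sym H e)) (trans (sym (-a-diff i j)) t))
  where
  -a-diff : ∀ i j → - a i - - a j ≡ a j - a i
  -a-diff i j = solve 2 (λ x y → :- x :- :- y := y :- x) refl (a i) (a j)

IsFacet-ᵀ : ∀ {n} {H : Graph n} {S} → IsFacet H S → IsFacet H (S ᵀ)
IsFacet-ᵀ {H = H} ((face , notFull) , maximal) =
  (IsFace-ᵀ {H = H} face , λ full → notFull (ᵀ-full {H = H} full)) ,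
  λ F (faceF , notFullF) Sᵀ⊆F i j e →
    maximal (F ᵀ) (IsFace-ᵀ {H = H} faceF , λ full → notFullF (ᵀ-full {H = H} full))
      (λ i j e → Sᵀ⊆F j i (adj-sym H e)) j i (adj-sym H e)

Supports : ∀ {n} → Graph n → PointSet n → (Fin n → ℚ) → ℚ → Set
Supports H S a c =
  (∀ i j → adj H i j ≡ true → (a i - a j) ≤ c) ×
  (∀ i j → adj H i j ≡ true → (S i j ≡ true → (a i - a j) ≡ c) × ((a i - a j) ≡ c → S i j ≡ true))

face-bound≤0⇒full : ∀ {n} (H : Graph n) (S : PointSet n) (a : Fin n → ℚ) (c : ℚ) → Supports H S a c →
  c ≤ 0ℚ → S ≈[ H ] Full H
face-bound≤0⇒full H S a c (bound , tight) c≤0 i j e =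
  trans (proj₂ (tight i j e) (≤-antisym (bound i j e) c≤aij)) (sym e)
  where
  c≤-c : c ≤ - c
  c≤-c = ≤-translate (+-mono-≤ c≤0 c≤0) (- c)
    (solve 1 (λ c → c :+ c :+ :- c := c) refl c) (solve 1 (λ c → con 0ℚ :+ con 0ℚ :+ :- c := :- c) refl c)
  c≤aij : c ≤ a i - a j
  c≤aij = ≤-trans c≤-c (subst (- c ≤_) (sym (-‿diff (a i) (a j))) (neg-antimono-≤ (bound j i (adj-sym H e))))

-- The bound c of a face containing both e_i - e_j and e_j - e_i satisfies 2c = 0.
face-antiparallel⇒full : ∀ {n} (H : Graph n) {S : PointSet n} → IsFace H S → ∀ {i j} → adj H i j ≡ true →
  S i j ≡ true → S j i ≡ true → S ≈[ H ] Full H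
face-antiparallel⇒full H {S} (a , c , supports@(_ , tight)) {i} {j} e sij sji =
  face-bound≤0⇒full H S a c supports c≤0
  where
  c+c≡0 : c + c ≡ 0ℚ
  c+c≡0 = trans (cong₂ _+_ (sym (proj₁ (tight i j e) sij)) (sym (proj₁ (tight j i (adj-sym H e)) sji)))
            (solve 2 (λ x y → x :- y :+ (y :- x) := con 0ℚ) refl (a i) (a j))
  c≤0 : c ≤ 0ℚ
  c≤0 with ≤-total c 0ℚ
  ... | inj₁ c≤0 = c≤0
  ... | inj₂ 0≤c = ≤-translate 0≤c c (solve 1 (λ c → con 0ℚ :+ c := c) refl c) c+c≡0

proper-face-bound-positive : ∀ {n} (H : Graph n) (S : PointSet n) (a : Fin n → ℚ) (c : ℚ) → Supports H S a c →
  ¬ (S ≈[ H ] Full H) → 0ℚ < c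
proper-face-bound-positive H S a c supports notFull with <-cmp c 0ℚ
... | tri< c<0 _ _ = ⊥-elim (notFull (face-bound≤0⇒full H S a c supports (<⇒≤ c<0)))
... | tri≈ _ c≡0 _ = ⊥-elim (notFull (face-bound≤0⇒full H S a c supports (≤-reflexive c≡0)))
... | tri> _ _ 0<c = 0<c

normalised-functional : ∀ {n} {H : Graph n} {S} → IsProperFace H S →
  Σ (Fin n → ℚ) λ b → (∀ i j → adj H i j ≡ true → b i - b j ≤ 1ℚ) ×
                      (∀ i j → adj H i j ≡ true → S i j ≡ true → b i - b j ≡ 1ℚ)
normalised-functional {H = H} {S} ((a , c , supports@(bound , tight)) , notFull) =
  (λ i → a i · w) ,
  (λ i j e → subst (_≤ 1ℚ) (sym (·-distribʳ-‿ (a i) (a j) w)) (proj₁ (proj₂ scaling) _ (bound i j e))) ,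
  λ i j e s → trans (·-distribʳ-‿ (a i) (a j) w)
                (trans (cong (_· w) (proj₁ (tight i j e) s)) (proj₂ (proj₂ scaling)))
  where
  scaling : Σ ℚ λ w → (∀ x → x ≤ c → x · w ≤ 1ℚ) × c · w ≡ 1ℚ
  scaling = scaled-to-one c (proper-face-bound-positive H S a c supports notFull)
  w : ℚ
  w = proj₁ scaling

UnitPotential : ∀ {n} → Graph n → (Fin n → ℚ) → Set
UnitPotential H g = ∀ i j → adj H i j ≡ true → (g i - g j) ≡±1

ascents : ∀ {n} → (Fin n → ℚ) → PointSet n
ascents g i j = does (g i - g j ≟ 1ℚ)

ascents-sound : ∀ {n} (g : Fin n → ℚ) i j → ascents g i j ≡ true → g i - g j ≡ 1ℚ
ascents-sound g i j ascent with g i - g j ≟ 1ℚ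
... | yes diff≡1 = diff≡1

ascents-complete : ∀ {n} (g : Fin n → ℚ) i j → g i - g j ≡ 1ℚ → ascents g i j ≡ true
ascents-complete g i j = dec-true (g i - g j ≟ 1ℚ)

ascents-cong : ∀ {m n} (g : Fin m → ℚ) (h : Fin n → ℚ) {i j k l} →
  g i - g j ≡ h k - h l → ascents g i j ≡ ascents h k l
ascents-cong g h eq = cong (λ d → does (d ≟ 1ℚ)) eq

ascents-reverse : ∀ {n} {H : Graph n} g → UnitPotential H g → ∀ {i j} → adj H i j ≡ true →
  ascents g j i ≡ not (ascents g i j)
ascents-reverse g unit {i} {j} e with unit i j e
... | inj₁ up =
  trans (dec-false (g j - g i ≟ 1ℚ) (λ ji≡1 → 1≢-1 (trans (sym ji≡1) (trans (-‿diff (g j) (g i)) (cong -_ up)))))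
                  (cong not (sym (ascents-complete g i j up)))
... | inj₂ down = trans (ascents-complete g j i (trans (-‿diff (g j) (g i)) (cong -_ down)))
                    (cong not (sym (dec-false (g i - g j ≟ 1ℚ) (λ ij≡1 → 1≢-1 (trans (sym ij≡1) down)))))

ascents-isFace : ∀ {n} {H : Graph n} g → UnitPotential H g → IsFace H (ascents g)
ascents-isFace g unit = g , 1ℚ , bound , λ i j e → ascents-sound g i j , ascents-complete g i j
  where
  bound : ∀ i j → _ → g i - g j ≤ 1ℚ
  bound i j e with unit i j e
  ... | inj₁ up = ≤-reflexive up
  ... | inj₂ down = subst (_≤ 1ℚ) (sym down) -1≤1

ascents-full⇒edgeless : ∀ {n} {H : Graph n} g → UnitPotential H g → ascents g ≈[ H ] Full H → Edgeless H
ascents-full⇒edgeless {H = H} g unit full i j e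
  with trans (sym (trans (full j i (adj-sym H e)) (adj-sym H e)))
             (trans (ascents-reverse {H = H} g unit e) (cong not (trans (full i j e) e)))
... | ()

ascents-isFacet : ∀ {n} {H : Graph n} g → UnitPotential H g → ¬ Edgeless H → IsFacet H (ascents g)
ascents-isFacet {H = H} g unit hasEdge =
  (ascents-isFace {H = H} g unit , λ full → hasEdge (ascents-full⇒edgeless {H = H} g unit full)) , maximal
  where
  maximal : ∀ F → IsProperFace H F → ascents g ⊆[ H ] F → F ≈[ H ] ascents g
  maximal F (faceF , notFullF) ⊆F i j e with ascents g i j in ascent
  ... | true = ⊆F i j e ascent
  ... | false with F i j in Fij
  ...   | false = refl
  ...   | true = ⊥-elim (notFullF (face-antiparallel⇒full H faceF e Fij
                   (⊆F j i (adj-sym H e) (trans (ascents-reverse {H = H} g unit e) (cong not ascent)))))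

ascents-of-≢-1 : ∀ {n} (g : Fin n → ℚ) i j → (g i - g j) ≡±1 → g i - g j ≢ - 1ℚ → ascents g i j ≡ true
ascents-of-≢-1 g i j (inj₁ up) _ = ascents-complete g i j up
ascents-of-≢-1 g i j (inj₂ down) notDown = ⊥-elim (notDown down)

-- Adjacent vertices are rounded to values of opposite parity, so their difference is odd, hence ±1.
rounded-unitPotential : ∀ {n} {H : Graph n} → Bipartite H → (b : Fin n → ℚ) →
  (∀ i j → adj H i j ≡ true → b i - b j ≤ 1ℚ) →
  Σ (Fin n → ℚ) λ g → UnitPotential H g × (∀ i j → adj H i j ≡ true → b i - b j ≡ 1ℚ → ascents g i j ≡ true)
rounded-unitPotential {H = H} (colour , proper) b diff≤1 = g , unit , keepsAscent
  where
  m : Fin _ → ℤ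
  m i = proj₁ (parity-rounding (b i) (colour i))
  g : Fin _ → ℚ
  g i = parityValue (m i) (colour i)
  rounds : ∀ i → Rounds (b i) (g i)
  rounds i = proj₂ (parity-rounding (b i) (colour i))
  unit : UnitPotential H g
  unit i j e = opposite-parity-≡±1 {b i} {b j} {m i} {m j} (colour i) (colour j) (proper i j e) (rounds i) (rounds j)
                 (diff≤1 i j e) (diff≤1 j i (adj-sym H e))
  keepsAscent : ∀ i j → adj H i j ≡ true → b i - b j ≡ 1ℚ → ascents g i j ≡ true
  keepsAscent i j e tight =
    ascents-of-≢-1 g i j (unit i j e) (rounding-keeps-ascent {b i} {b j} {g i} {g j} (rounds i) (rounds j) tight)

opaque
  facet-unitPotential : ∀ {n} {H : Graph n} {S} → Bipartite H → IsFacet H S →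
    Σ (Fin n → ℚ) λ g → UnitPotential H g × S ≈[ H ] ascents g
  facet-unitPotential {H = H} {S} bipartite (proper , maximal) =
    let (b , diff≤1 , S-tight) = normalised-functional {H = H} proper
        (g , unit , keepsAscent) = rounded-unitPotential {H = H} bipartite b diff≤1
        ascents-proper = proj₁ (ascents-isFacet {H = H} g unit
                                  (λ edgeless → proj₂ proper (edgeless⇒full {H = H} edgeless)))
        S⊆ascents = λ i j e s → keepsAscent i j e (S-tight i j e s)
    in g , unit , λ i j e → sym (maximal (ascents g) ascents-proper S⊆ascents i j e)

facet-reverse : ∀ {n} {H : Graph n} {S} → Bipartite H → IsFacet H S →
  ∀ {i j} → adj H i j ≡ true → S j i ≡ not (S i j)
facet-reverse {H = H} bipartite facet {i} {j} e =
  let (g , unit , S≈ascents) = facet-unitPotential {H = H} bipartite facet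
  in trans (S≈ascents j i (adj-sym H e)) (trans (ascents-reverse {H = H} g unit e) (cong not (sym (S≈ascents i j e))))

restrict : ∀ {m n} → (Fin m → Fin n) → PointSet n → PointSet m
restrict ι S x y = S (ι x) (ι y)

IsFacet-restrict : ∀ {m n} {H' : Graph m} {H : Graph n} (ι : Fin m → Fin n) →
  (∀ x y → adj H (ι x) (ι y) ≡ adj H' x y) → Bipartite H → ∀ {x₀ y₀} → adj H' x₀ y₀ ≡ true →
  ∀ {T} → IsFacet H T → IsFacet H' (restrict ι T)
IsFacet-restrict {H' = H'} {H} ι ι-adj bipartite {x₀} {y₀} e₀ facet =
  let (g , unit , T≈ascents) = facet-unitPotential {H = H} bipartite facet
  in IsFacet-resp-≈ {H = H'} (λ x y e → sym (T≈ascents (ι x) (ι y) (trans (ι-adj x y) e)))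
       (ascents-isFacet {H = H'} (λ x → g (ι x)) (λ x y e → unit (ι x) (ι y) (trans (ι-adj x y) e))
         (λ edgeless → edgeless x₀ y₀ e₀))

module FacetEnumeration {n f} {H : Graph n} (E : HasFacets H f) where

  facet : Fin f → PointSet n
  facet = proj₁ E

  facet-isFacet : ∀ k → IsFacet H (facet k)
  facet-isFacet = proj₁ (proj₂ E)

  facet-injective : ∀ k l → facet k ≈[ H ] facet l → k ≡ l
  facet-injective = proj₁ (proj₂ (proj₂ E))

  facet-complete : ∀ S → IsFacet H S → ∃ λ k → facet k ≈[ H ] S
  facet-complete = proj₂ (proj₂ (proj₂ E))

  opaque
    transposition : Σ (Fin f → Fin f) λ τ → Injective _≡_ _≡_ τ × ∀ l → facet (τ l) ≈[ H ] facet l ᵀ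
    transposition = τ , τ-injective , τ-transposes
      where
      τ : Fin f → Fin f
      τ l = proj₁ (facet-complete (facet l ᵀ) (IsFacet-ᵀ {H = H} (facet-isFacet l)))
      τ-transposes : ∀ l → facet (τ l) ≈[ H ] facet l ᵀ
      τ-transposes l = proj₂ (facet-complete (facet l ᵀ) (IsFacet-ᵀ {H = H} (facet-isFacet l)))
      τ-injective : Injective _≡_ _≡_ τ
      τ-injective {l} {l'} τl≡τl' = facet-injective l l' λ x y e →
        trans (sym (τ-transposes l y x (adj-sym H e)))
          (trans (cong (λ t → facet t y x) τl≡τl') (τ-transposes l' y x (adj-sym H e)))

record Enumeration {m} (P : Fin m → Bool) (b : Bool) : Set where
  field
    size : ℕ
    index : Fin size → Fin m
    index-injective : Injective _≡_ _≡_ index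
    index-sound : ∀ i → P (index i) ≡ b
    index-complete : ∀ l → P l ≡ b → ∃ λ i → index i ≡ l
open Enumeration

enumeration-∅ : ∀ {P : Fin 0 → Bool} {b} → Enumeration P b
enumeration-∅ = record
  { size = 0 ; index = λ () ; index-injective = λ { {()} } ; index-sound = λ () ; index-complete = λ () }

enumeration-skip : ∀ {m} {P : Fin (suc m) → Bool} {b} → P zero ≢ b →
  Enumeration (λ l → P (suc l)) b → Enumeration P b
enumeration-skip P0≢b E = record
  { size = size E
  ; index = λ i → suc (index E i)
  ; index-injective = λ eq → index-injective E (Fin.suc-injective eq)
  ; index-sound = index-sound E
  ; index-complete = λ { zero P0≡b → ⊥-elim (P0≢b P0≡b)
                       ; (suc l) Pl≡b → let (i , eq) = index-complete E l Pl≡b in i , cong suc eq }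
  }

enumeration-cons : ∀ {m} {P : Fin (suc m) → Bool} {b} → P zero ≡ b →
  Enumeration (λ l → P (suc l)) b → Enumeration P b
enumeration-cons {m} P0≡b E = record
  { size = suc (size E)
  ; index = index′
  ; index-injective = index′-injective
  ; index-sound = λ { zero → P0≡b ; (suc i) → index-sound E i }
  ; index-complete = λ { zero _ → zero , refl
                       ; (suc l) Pl≡b → let (i , eq) = index-complete E l Pl≡b in suc i , cong suc eq }
  }
  where
  index′ : Fin (suc (size E)) → Fin (suc m)
  index′ zero = zero
  index′ (suc i) = suc (index E i)
  index′-injective : Injective _≡_ _≡_ index′
  index′-injective {zero} {zero} _ = refl
  index′-injective {suc i} {suc j} eq = cong suc (index-injective E (Fin.suc-injective eq))

record Partition {m} (P : Fin m → Bool) : Set where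
  field
    trues : Enumeration P true
    falses : Enumeration P false
    sizes-sum : size trues ℕ.+ size falses ≡ m
open Partition

partition : ∀ {m} (P : Fin m → Bool) → Partition P
partition {zero} P = record { trues = enumeration-∅ ; falses = enumeration-∅ ; sizes-sum = refl }
partition {suc m} P with partition (λ l → P (suc l)) | P zero in P0
... | record { trues = ts ; falses = fs ; sizes-sum = sum } | true = record
  { trues = enumeration-cons P0 ts ; falses = enumeration-skip (not-¬ P0) fs ; sizes-sum = cong suc sum }
... | record { trues = ts ; falses = fs ; sizes-sum = sum } | false = record
  { trues = enumeration-skip (not-¬ P0) ts ; falses = enumeration-cons P0 fs
  ; sizes-sum = trans (ℕ.+-suc (size ts) (size fs)) (cong suc sum) }

enumeration-≤ : ∀ {m} {P : Fin m → Bool} {b b'} (E : Enumeration P b) (E' : Enumeration P b') (τ : Fin m → Fin m) →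
  Injective _≡_ _≡_ τ → (∀ l → P l ≡ b → P (τ l) ≡ b') → size E ℕ.≤ size E'
enumeration-≤ E E' τ τ-injective τ-maps = Fin.injective⇒≤ φ-injective
  where
  image : ∀ i → ∃ λ i' → index E' i' ≡ τ (index E i)
  image i = index-complete E' (τ (index E i)) (τ-maps (index E i) (index-sound E i))
  φ-injective : Injective _≡_ _≡_ (λ i → proj₁ (image i))
  φ-injective {i} {j} eq =
    index-injective E (τ-injective (trans (sym (proj₂ (image i))) (trans (cong (index E') eq) (proj₂ (image j)))))

partition-balanced : ∀ {m} {P : Fin m → Bool} (Π : Partition P) (τ : Fin m → Fin m) → Injective _≡_ _≡_ τ →
  (∀ l → P (τ l) ≡ not (P l)) → size (falses Π) ℕ.+ size (falses Π) ≡ m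
partition-balanced {P = P} Π τ τ-injective τ-flips = trans (cong (ℕ._+ size (falses Π)) (sym trues≡falses)) (sizes-sum Π)
  where
  τ-maps : ∀ {b} l → P l ≡ b → P (τ l) ≡ not b
  τ-maps l Pl≡b = trans (τ-flips l) (cong not Pl≡b)
  trues≡falses : size (trues Π) ≡ size (falses Π)
  trues≡falses = ℕ.≤-antisym (enumeration-≤ (trues Π) (falses Π) τ τ-injective τ-maps)
                              (enumeration-≤ (falses Π) (trues Π) τ τ-injective τ-maps)

xor-realign : ∀ {a b c d} → a ≢ b → c ≢ d → c xor (c xor a) ≡ a × d xor (c xor a) ≡ b
xor-realign {false} {false} a≢b _ = ⊥-elim (a≢b refl)
xor-realign {true} {true} a≢b _ = ⊥-elim (a≢b refl)
xor-realign {c = false} {false} _ c≢d = ⊥-elim (c≢d refl)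
xor-realign {c = true} {true} _ c≢d = ⊥-elim (c≢d refl)
xor-realign {false} {true} {false} {true} _ _ = refl , refl
xor-realign {false} {true} {true} {false} _ _ = refl , refl
xor-realign {true} {false} {false} {true} _ _ = refl , refl
xor-realign {true} {false} {true} {false} _ _ = refl , refl

xor-preserves-≢ : ∀ {a b} k → a ≢ b → a xor k ≢ b xor k
xor-preserves-≢ {false} {false} _ a≢b _ = a≢b refl
xor-preserves-≢ {true} {true} _ a≢b _ = a≢b refl
xor-preserves-≢ {false} {true} false _ ()
xor-preserves-≢ {false} {true} true _ ()
xor-preserves-≢ {true} {false} false _ ()
xor-preserves-≢ {true} {false} true _ ()

xor≡false⇒≡ : ∀ {a b} → a xor b ≡ false → a ≡ b
xor≡false⇒≡ {false} {false} _ = refl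
xor≡false⇒≡ {true} {true} _ = refl
xor≡false⇒≡ {false} {true} ()
xor≡false⇒≡ {true} {false} ()

≡⇒xor≡false : ∀ {a b} → a ≡ b → a xor b ≡ false
≡⇒xor≡false {false} refl = refl
≡⇒xor≡false {true} refl = refl

module Gluing {n₁ n₂ n} {G₁ : Graph n₁} {G₂ : Graph n₂} {G : Graph n} {v₁ w₁ v₂ w₂}
              (gluing : EdgeGluing G₁ G₂ G v₁ w₁ v₂ w₂) where
  open EdgeGluing gluing

  glued-edge-elim : (P : Fin n → Fin n → Set) → (∀ x y → adj G₁ x y ≡ true → P (ι₁ x) (ι₁ y)) →
    (∀ x y → adj G₂ x y ≡ true → P (ι₂ x) (ι₂ y)) → ∀ u u' → adj G u u' ≡ true → P u u'
  glued-edge-elim P on₁ on₂ u u' e with adj-from u u' e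
  ... | inj₁ (x , y , refl , refl , e₁) = on₁ x y e₁
  ... | inj₂ (x , y , refl , refl , e₂) = on₂ x y e₂

  ≈-from-restrictions : ∀ {T T'} → restrict ι₁ T ≈[ G₁ ] restrict ι₁ T' → restrict ι₂ T ≈[ G₂ ] restrict ι₂ T' →
    T ≈[ G ] T'
  ≈-from-restrictions {T} {T'} = glued-edge-elim (λ u u' → T u u' ≡ T' u u')

  Agree : {A : Set} → (Fin n₁ → A) → (Fin n₂ → A) → Set
  Agree f₁ f₂ = f₁ v₁ ≡ f₂ v₂ × f₁ w₁ ≡ f₂ w₂

  glue : {A : Set} → (Fin n₁ → A) → (Fin n₂ → A) → Fin n → A
  glue f₁ f₂ u = [ (λ (x , _) → f₁ x) , (λ (y , _) → f₂ y) ] (cover u)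

  agree-at-meet : ∀ {A : Set} {f₁ : Fin n₁ → A} {f₂} → Agree f₁ f₂ → ∀ {x y} → ι₁ x ≡ ι₂ y → f₁ x ≡ f₂ y
  agree-at-meet (agree-v , agree-w) {x} {y} ι₁x≡ι₂y with meet x y ι₁x≡ι₂y
  ... | inj₁ (refl , refl) = agree-v
  ... | inj₂ (refl , refl) = agree-w

  glue-ι₁ : ∀ {A : Set} {f₁ : Fin n₁ → A} {f₂} → Agree f₁ f₂ → ∀ x → glue f₁ f₂ (ι₁ x) ≡ f₁ x
  glue-ι₁ {f₁ = f₁} agree x with cover (ι₁ x)
  ... | inj₁ (x' , ι₁x'≡ι₁x) = cong f₁ (ι₁-inj x' x ι₁x'≡ι₁x)
  ... | inj₂ (y , ι₂y≡ι₁x) = sym (agree-at-meet agree (sym ι₂y≡ι₁x))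

  glue-ι₂ : ∀ {A : Set} {f₁ : Fin n₁ → A} {f₂} → Agree f₁ f₂ → ∀ y → glue f₁ f₂ (ι₂ y) ≡ f₂ y
  glue-ι₂ {f₂ = f₂} agree y with cover (ι₂ y)
  ... | inj₁ (x , ι₁x≡ι₂y) = agree-at-meet agree ι₁x≡ι₂y
  ... | inj₂ (y' , ι₂y'≡ι₂y) = cong f₂ (ι₂-inj y' y ι₂y'≡ι₂y)

  -- The colouring of G₂ is flipped if necessary so that it agrees with that of G₁ on the common edge.
  glue-bipartite : Bipartite G₁ → Bipartite G₂ → adj G₁ v₁ w₁ ≡ true → adj G₂ v₂ w₂ ≡ true → Bipartite G
  glue-bipartite (c₁ , proper₁) (c₂ , proper₂) e₁ e₂ =
    glue c₁ c₂′ , glued-edge-elim (λ u u' → glue c₁ c₂′ u ≢ glue c₁ c₂′ u')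
      (λ x y e same → proper₁ x y e (trans (sym (glue-ι₁ agree x)) (trans same (glue-ι₁ agree y))))
      (λ x y e same → xor-preserves-≢ k (proper₂ x y e) (trans (sym (glue-ι₂ agree x)) (trans same (glue-ι₂ agree y))))
    where
    k : Bool
    k = c₂ v₂ xor c₁ v₁
    c₂′ : Fin n₂ → Bool
    c₂′ y = c₂ y xor k
    agree : Agree c₁ c₂′
    agree = let (at-v , at-w) = xor-realign (proper₁ v₁ w₁ e₁) (proper₂ v₂ w₂ e₂) in sym at-v , sym at-w

  glue-unitPotential : ∀ {g₁ g₂} → UnitPotential G₁ g₁ → UnitPotential G₂ g₂ → g₁ v₁ - g₁ w₁ ≡ g₂ v₂ - g₂ w₂ →
    Σ (Fin n → ℚ) λ g → UnitPotential G g ×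
      (∀ x y → g (ι₁ x) - g (ι₁ y) ≡ g₁ x - g₁ y) × (∀ x y → g (ι₂ x) - g (ι₂ y) ≡ g₂ x - g₂ y)
  glue-unitPotential {g₁} {g₂} unit₁ unit₂ sameStep = g , unit , diffs₁ , diffs₂
    where
    δ : ℚ
    δ = g₁ v₁ - g₂ v₂
    g₂′ : Fin n₂ → ℚ
    g₂′ y = g₂ y + δ
    agree : Agree g₁ g₂′
    agree = solve 2 (λ a b → a := b :+ (a :- b)) refl (g₁ v₁) (g₂ v₂) ,
      (begin
        g₁ w₁                        ≡⟨ solve 2 (λ a c → c := a :- (a :- c)) refl (g₁ v₁) (g₁ w₁) ⟩
        g₁ v₁ - (g₁ v₁ - g₁ w₁)      ≡⟨ cong (_-_ (g₁ v₁)) sameStep ⟩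
        g₁ v₁ - (g₂ v₂ - g₂ w₂)      ≡⟨ solve 3 (λ a b d → a :- (b :- d) := d :+ (a :- b)) refl (g₁ v₁) (g₂ v₂) (g₂ w₂) ⟩
        g₂′ w₂                       ∎)
      where open ≡-Reasoning
    g : Fin n → ℚ
    g = glue g₁ g₂′
    diffs₁ : ∀ x y → g (ι₁ x) - g (ι₁ y) ≡ g₁ x - g₁ y
    diffs₁ x y = cong₂ _-_ (glue-ι₁ agree x) (glue-ι₁ agree y)
    diffs₂ : ∀ x y → g (ι₂ x) - g (ι₂ y) ≡ g₂ x - g₂ y
    diffs₂ x y = trans (cong₂ _-_ (glue-ι₂ agree x) (glue-ι₂ agree y))
                   (solve 3 (λ a b d → a :+ d :- (b :+ d) := a :- b) refl (g₂ x) (g₂ y) δ)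
    unit : UnitPotential G g
    unit = glued-edge-elim (λ u u' → (g u - g u') ≡±1)
      (λ x y e → subst _≡±1 (sym (diffs₁ x y)) (unit₁ x y e))
      (λ x y e → subst _≡±1 (sym (diffs₂ x y)) (unit₂ x y e))

  glue-facets : Bipartite G₁ → Bipartite G₂ → adj G₁ v₁ w₁ ≡ true → adj G₂ v₂ w₂ ≡ true →
    ∀ {S₁ S₂} → IsFacet G₁ S₁ → IsFacet G₂ S₂ → S₁ v₁ w₁ ≡ S₂ v₂ w₂ →
    Σ (PointSet n) λ T → IsFacet G T × restrict ι₁ T ≈[ G₁ ] S₁ × restrict ι₂ T ≈[ G₂ ] S₂
  glue-facets bip₁ bip₂ e₁ e₂ facet₁ facet₂ sameOrientation =
    let (g₁ , unit₁ , S₁≈ascents) = facet-unitPotential {H = G₁} bip₁ facet₁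
        (g₂ , unit₂ , S₂≈ascents) = facet-unitPotential {H = G₂} bip₂ facet₂
        sameStep = ≡±1-by-ascent (unit₁ v₁ w₁ e₁) (unit₂ v₂ w₂ e₂)
                     (trans (sym (S₁≈ascents v₁ w₁ e₁)) (trans sameOrientation (S₂≈ascents v₂ w₂ e₂)))
        (g , unit , diffs₁ , diffs₂) = glue-unitPotential {g₁} {g₂} unit₁ unit₂ sameStep
    in ascents g ,
       ascents-isFacet {H = G} g unit (λ edgeless → edgeless (ι₁ v₁) (ι₁ w₁) (trans (adj₁ v₁ w₁) e₁)) ,
       (λ x y e → trans (ascents-cong g g₁ (diffs₁ x y)) (sym (S₁≈ascents x y e))) ,
       (λ x y e → trans (ascents-cong g g₂ (diffs₂ x y)) (sym (S₂≈ascents x y e)))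

remQuot-injective : ∀ {m} k {p q : Fin (m * k)} → remQuot {m} k p ≡ remQuot k q → p ≡ q
remQuot-injective {m} k {p} {q} eq =
  trans (sym (Fin.combine-remQuot {m} k p)) (trans (cong (λ (i , j) → combine i j) eq) (Fin.combine-remQuot {m} k q))

-- Pairs of facets of G₁ and G₂ are indexed by Fin (f₁ * f₂); the facets of G are the agreeing pairs.
module GluedFacets {n₁ n₂ n} {G₁ : Graph n₁} {G₂ : Graph n₂} {G : Graph n} {v₁ w₁ v₂ w₂}
  (gluing : EdgeGluing G₁ G₂ G v₁ w₁ v₂ w₂) (bip₁ : Bipartite G₁) (bip₂ : Bipartite G₂)
  (e₁ : adj G₁ v₁ w₁ ≡ true) (e₂ : adj G₂ v₂ w₂ ≡ true)
  {f₁ f₂} (E₁ : HasFacets G₁ f₁) (E₂ : HasFacets G₂ f₂) where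
  open EdgeGluing gluing
  open Gluing gluing
  module F₁ = FacetEnumeration {H = G₁} E₁
  module F₂ = FacetEnumeration {H = G₂} E₂

  orientation₁ : Fin f₁ → Bool
  orientation₁ k = F₁.facet k v₁ w₁

  orientation₂ : Fin f₂ → Bool
  orientation₂ l = F₂.facet l v₂ w₂

  disagreeOn : Fin f₁ × Fin f₂ → Bool
  disagreeOn (k , l) = orientation₁ k xor orientation₂ l

  disagree : Fin (f₁ * f₂) → Bool
  disagree p = disagreeOn (remQuot {f₁} f₂ p)

  τ : Fin f₂ → Fin f₂
  τ = proj₁ F₂.transposition

  τ-injective : Injective _≡_ _≡_ τ
  τ-injective = proj₁ (proj₂ F₂.transposition)

  τ-reverses : ∀ l → orientation₂ (τ l) ≡ not (orientation₂ l)
  τ-reverses l =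
    trans (proj₂ (proj₂ F₂.transposition) l v₂ w₂ e₂) (facet-reverse {H = G₂} bip₂ (F₂.facet-isFacet l) e₂)

  flip : Fin (f₁ * f₂) → Fin (f₁ * f₂)
  flip p = let (k , l) = remQuot {f₁} f₂ p in combine k (τ l)

  flip-injective : Injective _≡_ _≡_ flip
  flip-injective {p} {q} eq =
    let (k , l) = remQuot {f₁} f₂ p
        (k' , l') = remQuot {f₁} f₂ q
        (k≡k' , τl≡τl') = Fin.combine-injective k (τ l) k' (τ l') eq
    in remQuot-injective {f₁} f₂ (cong₂ _,_ k≡k' (τ-injective τl≡τl'))

  disagree-flip : ∀ p → disagree (flip p) ≡ not (disagree p)
  disagree-flip p = begin
    disagree (flip p)                       ≡⟨ cong disagreeOn (Fin.remQuot-combine k (τ l)) ⟩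
    orientation₁ k xor orientation₂ (τ l)   ≡⟨ cong (orientation₁ k xor_) (τ-reverses l) ⟩
    orientation₁ k xor not (orientation₂ l) ≡⟨ sym (not-distribʳ-xor (orientation₁ k) (orientation₂ l)) ⟩
    not (disagree p)                        ∎
    where
    open ≡-Reasoning
    k = proj₁ (remQuot {f₁} f₂ p)
    l = proj₂ (remQuot {f₁} f₂ p)

  agreeing : Enumeration disagree false
  agreeing = falses (partition disagree)

  agreeing-count : size agreeing ℕ.+ size agreeing ≡ f₁ * f₂
  agreeing-count = partition-balanced (partition disagree) flip flip-injective disagree-flip

  pair : Fin (size agreeing) → Fin f₁ × Fin f₂
  pair i = remQuot {f₁} f₂ (index agreeing i)

  opaque
    glued : ∀ i → Σ (PointSet n) λ T → IsFacet G T ×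
      restrict ι₁ T ≈[ G₁ ] F₁.facet (proj₁ (pair i)) × restrict ι₂ T ≈[ G₂ ] F₂.facet (proj₂ (pair i))
    glued i =
      glue-facets bip₁ bip₂ e₁ e₂ (F₁.facet-isFacet _) (F₂.facet-isFacet _) (xor≡false⇒≡ (index-sound agreeing i))

  gluedFacet : Fin (size agreeing) → PointSet n
  gluedFacet i = proj₁ (glued i)

  gluedFacet-restrict₁ : ∀ i → restrict ι₁ (gluedFacet i) ≈[ G₁ ] F₁.facet (proj₁ (pair i))
  gluedFacet-restrict₁ i = proj₁ (proj₂ (proj₂ (glued i)))

  gluedFacet-restrict₂ : ∀ i → restrict ι₂ (gluedFacet i) ≈[ G₂ ] F₂.facet (proj₂ (pair i))
  gluedFacet-restrict₂ i = proj₂ (proj₂ (proj₂ (glued i)))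

  gluedFacet-injective : ∀ i j → gluedFacet i ≈[ G ] gluedFacet j → i ≡ j
  gluedFacet-injective i j Ti≈Tj = index-injective agreeing (remQuot-injective {f₁} f₂ (cong₂ _,_
    (F₁.facet-injective _ _ λ x y e → trans (sym (gluedFacet-restrict₁ i x y e))
      (trans (Ti≈Tj (ι₁ x) (ι₁ y) (trans (adj₁ x y) e)) (gluedFacet-restrict₁ j x y e)))
    (F₂.facet-injective _ _ λ x y e → trans (sym (gluedFacet-restrict₂ i x y e))
      (trans (Ti≈Tj (ι₂ x) (ι₂ y) (trans (adj₂ x y) e)) (gluedFacet-restrict₂ j x y e)))))

  agreeing-pair : ∀ k l → orientation₁ k ≡ orientation₂ l → ∃ λ i → pair i ≡ (k , l)
  agreeing-pair k l same =
    let (i , index-i) = index-complete agreeing (combine k l)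
          (trans (cong disagreeOn (Fin.remQuot-combine k l)) (≡⇒xor≡false same))
    in i , trans (cong (remQuot {f₁} f₂) index-i) (Fin.remQuot-combine k l)

  restrict₁-isFacet : ∀ {T} → IsFacet G T → IsFacet G₁ (restrict ι₁ T)
  restrict₁-isFacet = IsFacet-restrict {H' = G₁} {G} ι₁ adj₁ (glue-bipartite bip₁ bip₂ e₁ e₂) e₁

  restrict₂-isFacet : ∀ {T} → IsFacet G T → IsFacet G₂ (restrict ι₂ T)
  restrict₂-isFacet = IsFacet-restrict {H' = G₂} {G} ι₂ adj₂ (glue-bipartite bip₁ bip₂ e₁ e₂) e₂

  gluedFacet-complete : ∀ T → IsFacet G T → ∃ λ i → gluedFacet i ≈[ G ] T
  gluedFacet-complete T facet =
    let (k , Fk≈) = F₁.facet-complete (restrict ι₁ T) (restrict₁-isFacet {T} facet)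
        (l , Fl≈) = F₂.facet-complete (restrict ι₂ T) (restrict₂-isFacet {T} facet)
        (i , pair-i) = agreeing-pair k l (trans (Fk≈ v₁ w₁ e₁) (trans (cong₂ T glue-v glue-w) (sym (Fl≈ v₂ w₂ e₂))))
    in i , ≈-from-restrictions
      (λ x y e → trans (gluedFacet-restrict₁ i x y e) (trans (cong (λ (k , _) → F₁.facet k x y) pair-i) (Fk≈ x y e)))
      (λ x y e → trans (gluedFacet-restrict₂ i x y e) (trans (cong (λ (_ , l) → F₂.facet l x y) pair-i) (Fl≈ x y e)))

  glued-facets : HasFacets G (size agreeing)
  glued-facets = gluedFacet , (λ i → proj₁ (proj₂ (glued i))) , gluedFacet-injective , gluedFacet-complete

proposition4p10 : {n₁ n₂ n : ℕ} (G₁ : Graph n₁) (G₂ : Graph n₂) (G : Graph n)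
    (v₁ w₁ : Fin n₁) (v₂ w₂ : Fin n₂) (f₁ f₂ : ℕ) →
    Connected G₁ → Bipartite G₁ → Connected G₂ → Bipartite G₂ →
    adj G₁ v₁ w₁ ≡ true → adj G₂ v₂ w₂ ≡ true →
    HasFacets G₁ f₁ → HasFacets G₂ f₂ →
    EdgeGluing G₁ G₂ G v₁ w₁ v₂ w₂ →
    Σ ℕ λ f → HasFacets G f × 2 * f ≡ f₁ * f₂
proposition4p10 G₁ G₂ G v₁ w₁ v₂ w₂ f₁ f₂ _ bip₁ _ bip₂ e₁ e₂ E₁ E₂ gluing =
  size agreeing , glued-facets , trans (cong (size agreeing ℕ.+_) (ℕ.+-identityʳ (size agreeing))) agreeing-count
  where open GluedFacets gluing bip₁ bip₂ e₁ e₂ E₁ E₂
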